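{- Let $\mathbf{c}_1,\dots,\mathbf{c}_m$ be an $F$-orbit of compositions, i.e. $\mathbf{c}_{i+1}=F(\mathbf{c}_i)$ for $1\le i<m$ and $F(\mathbf{c}_m)=\mathbf{c}_1$, with parity vector $\mathbf{p}=(p_1,\dots,p_m)$. Let $A_1\in\{P,I\}$ and define $A_{i+1}=A_i$ if $\mathbf{c}_i$ has an odd number of entries and $A_{i+1}=A_i'$ if it has an even number of entries ($1\le i<m$); put $\mathbf{d}_i=A_i(\mathbf{c}_i)$ and $B(\mathbf{c}_1,A_1)=(\mathbf{d}_1,\dots,\mathbf{d}_m)$. Then, with all arithmetic modulo $2$, the parity vector of $B(\mathbf{c}_1,A_1)$ is \[ \mathbf{S}\mathbf{p}+\mathbf{S}\mathbf{e}_m+A_1\,\mathbf{e}_m . \]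
   Context: On nonempty compositions define the augmentation operators $P$: prepend an entry $1$, and $I$: add $1$ to the first entry; for an augmentation operator $A$, $A'$ is the other one. For arithmetic mod $2$, $P$ is identified with $0$ and $I$ with $1$. The parity $p(\mathbf{c})$ of a composition is $1$ if it has an odd number of entries and $0$ otherwise; the parity vector of a sequence of compositions is the vector of their parities. $\mathbf{S}$ is the mod-2 partial sum operator on bit sequences, $\mathbf{S}(\epsilon_1,\dots,\epsilon_m)=(\epsilon_1,\epsilon_1+\epsilon_2,\dots,\epsilon_1+\cdots+\epsilon_m)$, and $\mathbf{e}_m$ is the all-ones vector of length $m$. The map $F$ on compositions: number entries of $(c_1,\dots,c_h)$ from the end ($c_h$ in position 1); simultaneously, each entry $c$ in an even position is replaced by $c-1$ entries $1$ and its left neighbor is increased by $1$, a missing left neighbor of $c_1$ being regarded as an entry $0$ that becomes $1$ (e.g. $(2,1)\mapsto(1,1,1)$). -}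

module Defs where

open import Data.Nat using (ℕ; zero; suc; _∸_; _≤_)
open import Data.Bool using (Bool; true; false; not; _xor_; if_then_else_)
open import Data.List using (List; []; _∷_; _++_; reverse; replicate)
open import Data.List.Relation.Unary.All using (All)
open import Data.Vec as V using (Vec; []; _∷_)
open import Data.Product using (_×_)
open import Relation.Binary.PropositionalEquality using (_≢_)

IsComposition : List ℕ → Set
IsComposition c = (c ≢ []) × All (λ x → 1 ≤ x) c

data Aug : Set where
  P I : Aug

bit : Aug → Bool
bit P = false
bit I = true

other : Aug → Aug
other P = I
other I = P

apply : Aug → List ℕ → List ℕ
apply P c = 1 ∷ c
apply I [] = []            -- not used: compositions are nonempty
apply I (x ∷ xs) = suc x ∷ xs

parity : List ℕ → Bool
parity [] = false
parity (_ ∷ xs) = not (parity xs)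

-- We work on the reversed composition, whose head is the
-- entry in position 1 (counted from the end).  'go a rest' processes a list
-- whose head a is in an odd position.  An even-position entry b becomes
-- b-1 ones and its left neighbour x (next in reversed order) becomes x+1;
-- a missing left neighbour is a 0 which becomes 1.
private
  go : ℕ → List ℕ → List ℕ
  go a [] = a ∷ []
  go a (b ∷ []) = a ∷ (replicate (b ∸ 1) 1 ++ (1 ∷ []))
  go a (b ∷ x ∷ rest) = a ∷ (replicate (b ∸ 1) 1 ++ go (suc x) rest)

F : List ℕ → List ℕ
F c with reverse c
... | [] = []
... | a ∷ rest = reverse (go a rest)

S : ∀ {m} → Vec Bool m → Vec Bool m
S [] = []
S (x ∷ xs) = x ∷ V.map (x xor_) (S xs)

augs : ∀ {m} → Aug → Vec (List ℕ) m → Vec Aug m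
augs A [] = []
augs A (c ∷ cs) = A ∷ augs (if parity c then A else other A) cs

B : ∀ {m} → Vec (List ℕ) m → Aug → Vec (List ℕ) m
B cs A₁ = V.zipWith apply (augs A₁ cs) cs

parityVec : ∀ {m} → Vec (List ℕ) m → Vec Bool m
parityVec = V.map parity

_⊕_ : ∀ {m} → Vec Bool m → Vec Bool m → Vec Bool m
_⊕_ = V.zipWith _xor_

module Submission where

open import Defs
open import Data.Nat using (ℕ; suc; _≤_)
open import Data.Fin using (Fin; toℕ)
open import Data.Bool using (Bool; true; false; not; _xor_; if_then_else_)
open import Data.Bool.Properties using (xor-assoc; xor-comm; xor-∧-commutativeRing)
open import Data.List using (List; []; _∷_)
open import Data.Vec using (Vec; lookup; replicate; []; _∷_; map)
open import Data.Vec.Properties using (map-∘; map-cong)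
open import Algebra.Bundles using (CommutativeRing)
open import Algebra.Properties.CommutativeSemigroup
  (CommutativeRing.+-commutativeSemigroup xor-∧-commutativeRing) using (interchange)
open import Relation.Binary.PropositionalEquality
  using (_≡_; refl; sym; cong; cong₂; module ≡-Reasoning)

-- Writing aᵢ = bit Aᵢ and qᵢ = 1 + pᵢ, both the parity of dᵢ and a_{i+1} equal aᵢ + qᵢ.
-- Hence the parities of the dᵢ are the partial sums a₁ + q₁ + ⋯ + qᵢ, i.e. a₁ eₘ + S q,
-- and S q = S p + S eₘ since S is linear.

next : Aug → List ℕ → Aug
next A c = if parity c then A else other A

parity-apply : ∀ A c → parity (apply A c) ≡ bit A xor not (parity c)
parity-apply P c    = refl
parity-apply I []   = refl
parity-apply I (_ ∷ c) with parity c
... | true  = refl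
... | false = refl

bit-next : ∀ A c → bit (next A c) ≡ bit A xor not (parity c)
bit-next A c with parity c
bit-next P c | true  = refl
bit-next I c | true  = refl
bit-next P c | false = refl
bit-next I c | false = refl

map-xor-assoc : ∀ {n} a b (u : Vec Bool n) →
                map ((a xor b) xor_) u ≡ map (a xor_) (map (b xor_) u)
map-xor-assoc a b u = begin
  map ((a xor b) xor_) u       ≡⟨ map-cong (xor-assoc a b) u ⟩
  map (λ x → a xor b xor x) u  ≡⟨ map-∘ (a xor_) (b xor_) u ⟩
  map (a xor_) (map (b xor_) u) ∎
  where open ≡-Reasoning

map-xor≡⊕-replicate : ∀ {n} a (u : Vec Bool n) → map (a xor_) u ≡ u ⊕ replicate n a
map-xor≡⊕-replicate a []      = refl
map-xor≡⊕-replicate a (x ∷ u) = cong₂ _∷_ (xor-comm a x) (map-xor≡⊕-replicate a u)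

map-xor-⊕ : ∀ {n} a b (u v : Vec Bool n) →
            map (a xor_) u ⊕ map (b xor_) v ≡ map ((a xor b) xor_) (u ⊕ v)
map-xor-⊕ a b []      []      = refl
map-xor-⊕ a b (x ∷ u) (y ∷ v) = cong₂ _∷_ (interchange a x b y) (map-xor-⊕ a b u v)

S-⊕ : ∀ {n} (u v : Vec Bool n) → S (u ⊕ v) ≡ S u ⊕ S v
S-⊕ []      []      = refl
S-⊕ (x ∷ u) (y ∷ v) = cong ((x xor y) ∷_) (begin
  map ((x xor y) xor_) (S (u ⊕ v))      ≡⟨ cong (map ((x xor y) xor_)) (S-⊕ u v) ⟩
  map ((x xor y) xor_) (S u ⊕ S v)      ≡⟨ sym (map-xor-⊕ x y (S u) (S v)) ⟩
  map (x xor_) (S u) ⊕ map (y xor_) (S v) ∎)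
  where open ≡-Reasoning

parityVec-B : ∀ {m} (cs : Vec (List ℕ) m) A →
              parityVec (B cs A) ≡ map (bit A xor_) (S (map not (parityVec cs)))
parityVec-B []       A = refl
parityVec-B (c ∷ cs) A = cong₂ _∷_ (parity-apply A c) (begin
  parityVec (B cs (next A c))                   ≡⟨ parityVec-B cs (next A c) ⟩
  map (bit (next A c) xor_) (S q)               ≡⟨ cong (λ a → map (a xor_) (S q)) (bit-next A c) ⟩
  map ((bit A xor not (parity c)) xor_) (S q)   ≡⟨ map-xor-assoc (bit A) (not (parity c)) (S q) ⟩
  map (bit A xor_) (map (not (parity c) xor_) (S q)) ∎)
  where
  open ≡-Reasoning
  q = map not (parityVec cs)

lemma5 : (m : ℕ) → 1 ≤ m → (cs : Vec (List ℕ) m) → (∀ i → IsComposition (lookup cs i))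
    → (∀ (i j : Fin m) → toℕ j ≡ suc (toℕ i) → F (lookup cs i) ≡ lookup cs j)
    → (∀ (i j : Fin m) → suc (toℕ i) ≡ m → toℕ j ≡ 0 → F (lookup cs i) ≡ lookup cs j)
    → (A₁ : Aug)
    → parityVec (B cs A₁)
      ≡ ((S (parityVec cs) ⊕ S (replicate m true)) ⊕ replicate m (bit A₁))
lemma5 m _ cs _ _ _ A₁ = begin
  parityVec (B cs A₁)                               ≡⟨ parityVec-B cs A₁ ⟩
  map (bit A₁ xor_) (S (map not p))                 ≡⟨ map-xor≡⊕-replicate (bit A₁) _ ⟩
  S (map not p) ⊕ replicate m (bit A₁)              ≡⟨ cong (λ u → S u ⊕ replicate m (bit A₁))
                                                         (map-xor≡⊕-replicate true p) ⟩
  S (p ⊕ replicate m true) ⊕ replicate m (bit A₁)   ≡⟨ cong (_⊕ replicate m (bit A₁))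
                                                         (S-⊕ p (replicate m true)) ⟩
  (S p ⊕ S (replicate m true)) ⊕ replicate m (bit A₁) ∎
  where
  open ≡-Reasoning
  p = parityVec cs
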